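{- Let $l,s,w\in\mathbb{N}$, let $G$ be a graph and let $\mathcal{Q},\mathcal{Q}'$ be $((s+1)^{l+1}w^{l^2})$-polypaths in $G$ with $V(\mathcal{Q})\cap V(\mathcal{Q}')=\emptyset$. Then one of the following holds: (a) there exists an $(s,l)$-cluster $(S,\mathcal{L})$ in $G$ such that either $S\subseteq V(\mathcal{Q})$ and $\mathcal{L}\subseteq\mathcal{Q}'$, or $S\subseteq V(\mathcal{Q}')$ and $\mathcal{L}\subseteq\mathcal{Q}$; (b) there exist $\mathcal{W}\subseteq\mathcal{Q}$ and $\mathcal{W}'\subseteq\mathcal{Q}'$ with $|\mathcal{W}|=|\mathcal{W}'|=w$ such that every vertex in $V(\mathcal{W})$ has neighbors in fewer than $l$ paths in $\mathcal{W}'$, and every vertex in $V(\mathcal{W}')$ has neighbors in fewer than $l$ paths in $\mathcal{W}$.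
   Context: A path in $G$ is an induced subgraph that is a path. A $w$-polypath in $G$ is a set of $w$ pairwise disjoint paths in $G$; $V(\mathcal{W})$ denotes the union of the vertex sets of the paths in $\mathcal{W}$. An $(s,l)$-cluster in $G$ is a pair $(S,\mathcal{L})$ with $S\subseteq V(G)$, $|S|=s$, and $\mathcal{L}$ an $l$-polypath in $G\setminus S$ such that every vertex of $S$ has at least one neighbor in every path of $\mathcal{L}$. -}

module Defs where

open import Data.Nat using (ℕ; suc; _<_)
open import Data.Fin using (Fin; toℕ)
open import Data.Fin.Subset using (Subset; _∈_; _∉_; _∩_; Nonempty; ∣_∣)
open import Data.Fin.Subset.Properties using (nonempty?)
open import Data.Bool using (Bool; true; false)
open import Data.Vec using (tabulate)
open import Data.Product using (Σ; ∃; _×_)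
open import Data.Sum using (_⊎_)
open import Function.Bundles using (_⇔_)
open import Function.Definitions using (Injective)
open import Relation.Binary.PropositionalEquality using (_≡_; _≢_)
open import Relation.Nullary.Decidable using (⌊_⌋)

record Graph : Set where
  field
    n      : ℕ
    adj    : Fin n → Fin n → Bool
    sym    : ∀ u v → adj u v ≡ adj v u
    irrefl : ∀ v → adj v v ≡ false

open Graph public

Vertex : Graph → Set
Vertex G = Fin (n G)

VSet : Graph → Set
VSet G = Subset (n G)

Adj : (G : Graph) → Vertex G → Vertex G → Set
Adj G u v = adj G u v ≡ true

-- P ⊆ V(G) induces a path in G: there is an injective enumeration
-- p₀,…,p_k of P (k ≥ 0) such that p_i p_j is an edge iff |i - j| = 1.
IsPath : (G : Graph) → VSet G → Set
IsPath G P =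
  Σ ℕ λ k → Σ (Fin (suc k) → Vertex G) λ p →
    Injective _≡_ _≡_ p
    × (∀ v → (v ∈ P) ⇔ (∃ λ i → p i ≡ v))
    × (∀ i j → Adj G (p i) (p j) ⇔ (toℕ i ≡ suc (toℕ j) ⊎ toℕ j ≡ suc (toℕ i)))

Family : Graph → ℕ → Set
Family G w = Fin w → VSet G

-- 𝓦 is a w-polypath: w pairwise (vertex-)disjoint paths
-- (distinct indices give disjoint, hence distinct, paths).
IsPolypath : (G : Graph) (w : ℕ) → Family G w → Set
IsPolypath G w 𝓦 =
  (∀ i → IsPath G (𝓦 i))
  × (∀ i j → i ≢ j → ∀ v → v ∈ 𝓦 i → v ∉ 𝓦 j)

InV : (G : Graph) {w : ℕ} → Vertex G → Family G w → Set
InV G v 𝓦 = ∃ λ i → v ∈ 𝓦 i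

SubFam : (G : Graph) {a b : ℕ} → Family G a → Family G b → Set
SubFam G 𝓛 𝓠 = ∀ i → ∃ λ j → 𝓛 i ≡ 𝓠 j

Nbhd : (G : Graph) → Vertex G → VSet G
Nbhd G v = tabulate (adj G v)

HasNbrIn : (G : Graph) → Vertex G → VSet G → Set
HasNbrIn G v P = Nonempty (P ∩ Nbhd G v)

nbrPaths : (G : Graph) {w : ℕ} → Vertex G → Family G w → Subset w
nbrPaths G v 𝓦 = tabulate (λ i → ⌊ nonempty? (𝓦 i ∩ Nbhd G v) ⌋)

#nbrPaths : (G : Graph) {w : ℕ} → Vertex G → Family G w → ℕ
#nbrPaths G v 𝓦 = ∣ nbrPaths G v 𝓦 ∣

IsCluster : (G : Graph) (s l : ℕ) → VSet G → Family G l → Set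
IsCluster G s l S 𝓛 =
  ∣ S ∣ ≡ s
  × IsPolypath G l 𝓛
  × (∀ v → InV G v 𝓛 → v ∉ S)
  × (∀ v → v ∈ S → ∀ i → HasNbrIn G v (𝓛 i))

-- Call a path of 𝓐 dense if one of its vertices has neighbours in at least l paths
-- of a polypath 𝓕 with u paths. Label each dense path by l such paths of 𝓕 (one of
-- u ^ l labels): s dense paths sharing a label form an (s,l)-cluster, and otherwise at
-- most (s − 1) u ^ l paths of 𝓐 are dense, all others being sparse towards 𝓕.
-- Applying this from 𝓠 to t = w + (s − 1) w ^ l paths of 𝓠′, and then from those t
-- paths to the w sparse paths of 𝓠 just found, gives the two sparse families; the
-- size (s + 1) ^ (l + 1) w ^ (l l) of 𝓠 is what the first application needs.
module Submission where

open import Defs hiding (sym)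

open import Data.Bool.Properties using (T-≡)
open import Data.Empty using (⊥-elim)
open import Data.Fin using (Fin; zero; suc; _≟_; punchOut; inject≤; finToFun; funToFin)
open import Data.Fin.Properties
  using (any?; suc-injective; ¬Fin0; injective⇒≤; punchIn-punchOut; inject≤-injective;
         finToFun-funToFin)
open import Data.Fin.Subset using (Subset; _∈_; _∉_; ∣_∣; inside; outside; ∁; Nonempty; _∩_)
open import Data.Fin.Subset.Properties using (∣∁p∣≡n∸∣p∣; x∈∁p⇒x∉p; _∈?_; nonempty?)
open import Data.Nat using (ℕ; zero; suc; _+_; _*_; _∸_; _^_; _≤_; _<_; z≤n; s≤s; _≤?_; _<?_)
open import Data.Nat.Properties hiding (suc-injective; _≟_)
open import Algebra.Properties.CommutativeSemigroup *-commutativeSemigroup using (interchange)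
open import Data.Product using (Σ; ∃; _×_; _,_; proj₁; proj₂)
open import Data.Sum using (_⊎_; inj₁; inj₂)
open import Data.Vec using (_∷_; here; there; tabulate)
open import Data.Vec.Properties using ([]=⇒lookup; lookup⇒[]=; lookup∘tabulate)
open import Function using (id; _∘_; case_of_; Injective)
open import Function.Bundles using (Equivalence)
open import Relation.Nullary using (¬_; yes; no; _×-dec_; contradiction)
open import Relation.Nullary.Decidable using (⌊_⌋; toWitness; fromWitness)
open import Relation.Unary using (Pred; Decidable)
open import Relation.Binary.PropositionalEquality
  using (_≡_; _≢_; refl; sym; trans; cong; subst; module ≡-Reasoning)

subsetOf : ∀ {n p} {P : Pred (Fin n) p} → Decidable P → Subset n
subsetOf P? = tabulate (λ i → ⌊ P? i ⌋)

module _ {n p} {P : Pred (Fin n) p} (P? : Decidable P) where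

  ∈-subsetOf⁺ : ∀ {i} → P i → i ∈ subsetOf P?
  ∈-subsetOf⁺ {i} p = lookup⇒[]= i _
    (trans (lookup∘tabulate _ i) (Equivalence.to T-≡ (fromWitness p)))

  ∈-subsetOf⁻ : ∀ {i} → i ∈ subsetOf P? → P i
  ∈-subsetOf⁻ {i} i∈ = toWitness
    (Equivalence.from T-≡ (trans (sym (lookup∘tabulate _ i)) ([]=⇒lookup i∈)))

record _↪_ (k : ℕ) {n : ℕ} (p : Subset n) : Set where
  field
    to        : Fin k → Fin n
    injective : Injective _≡_ _≡_ to
    to-∈      : ∀ i → to i ∈ p

open _↪_

≤∣p∣⇒↪ : ∀ {k n} (p : Subset n) → k ≤ ∣ p ∣ → k ↪ p
≤∣p∣⇒↪ {zero} p _ = record { to = λ () ; injective = λ { {()} } ; to-∈ = λ () }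
≤∣p∣⇒↪ {suc k} (inside ∷ p) (s≤s k≤) = record
  { to = λ { zero → zero ; (suc i) → suc (to e i) }
  ; injective = λ { {zero} {zero} _ → refl
                  ; {zero} {suc _} () ; {suc _} {zero} ()
                  ; {suc i} {suc j} eq → cong suc (injective e (suc-injective eq)) }
  ; to-∈ = λ { zero → here ; (suc i) → there (to-∈ e i) }
  }
  where e = ≤∣p∣⇒↪ p k≤
≤∣p∣⇒↪ {suc k} (outside ∷ p) k≤ = record
  { to = suc ∘ to e
  ; injective = injective e ∘ suc-injective
  ; to-∈ = there ∘ to-∈ e
  }
  where e = ≤∣p∣⇒↪ p k≤

rank : ∀ {n} (p : Subset n) {i : Fin n} → i ∈ p → Fin ∣ p ∣
rank (inside ∷ p) here = zero
rank (inside ∷ p) (there i∈p) = suc (rank p i∈p)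
rank (outside ∷ p) (there i∈p) = rank p i∈p

rank-injective : ∀ {n} (p : Subset n) {i j : Fin n} (i∈p : i ∈ p) (j∈p : j ∈ p) →
                 rank p i∈p ≡ rank p j∈p → i ≡ j
rank-injective (inside ∷ p) here here _ = refl
rank-injective (inside ∷ p) (there i∈p) (there j∈p) eq =
  cong suc (rank-injective p i∈p j∈p (suc-injective eq))
rank-injective (outside ∷ p) (there i∈p) (there j∈p) eq =
  cong suc (rank-injective p i∈p j∈p eq)

↪⇒≤∣p∣ : ∀ {k n} {p : Subset n} → k ↪ p → k ≤ ∣ p ∣
↪⇒≤∣p∣ {p = p} e = injective⇒≤ λ eq →
  injective e (rank-injective p (to-∈ e _) (to-∈ e _) eq)

↪-map : ∀ {k n m} {p : Subset n} {q : Subset m} (f : Fin n → Fin m) →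
        Injective _≡_ _≡_ f → (∀ {i} → i ∈ p → f i ∈ q) → k ↪ p → k ↪ q
↪-map f f-inj f-resp e = record
  { to = f ∘ to e ; injective = injective e ∘ f-inj ; to-∈ = f-resp ∘ to-∈ e }

image : ∀ {k n} → (Fin k → Fin n) → Subset n
image f = subsetOf (λ v → any? (λ i → f i ≟ v))

module _ {k n} (f : Fin k → Fin n) where

  ∈-image⁺ : ∀ i → f i ∈ image f
  ∈-image⁺ i = ∈-subsetOf⁺ (λ v → any? (λ i → f i ≟ v)) (i , refl)

  ∈-image⁻ : ∀ {v} → v ∈ image f → ∃ λ i → f i ≡ v
  ∈-image⁻ = ∈-subsetOf⁻ (λ v → any? (λ i → f i ≟ v))

  ∣image∣≡ : Injective _≡_ _≡_ f → ∣ image f ∣ ≡ k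
  ∣image∣≡ f-inj = ≤-antisym (injective⇒≤ preimage-injective) (↪⇒≤∣p∣ f↪)
    where
    f↪ : k ↪ image f
    f↪ = record { to = f ; injective = f-inj ; to-∈ = ∈-image⁺ }
    enum : ∣ image f ∣ ↪ image f
    enum = ≤∣p∣⇒↪ (image f) ≤-refl
    preimage : Fin ∣ image f ∣ → Fin k
    preimage i = proj₁ (∈-image⁻ (to-∈ enum i))
    preimage-injective : Injective _≡_ _≡_ preimage
    preimage-injective {i} {j} eq = injective enum (begin
      to enum i ≡˘⟨ proj₂ (∈-image⁻ (to-∈ enum i)) ⟩
      f (preimage i) ≡⟨ cong f eq ⟩
      f (preimage j) ≡⟨ proj₂ (∈-image⁻ (to-∈ enum j)) ⟩
      to enum j ∎)
      where open ≡-Reasoning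

fibre : ∀ {b m} → (Fin b → Fin m) → Fin m → Subset b
fibre f c = subsetOf (λ i → f i ≟ c)

pigeonhole-fibre : ∀ {b m} k (f : Fin b → Fin m) → k * m < b → ∃ λ c → suc k ↪ fibre f c
pigeonhole-fibre {zero} k f ()
pigeonhole-fibre {suc b} {zero} k f _ = ⊥-elim (¬Fin0 (f zero))
pigeonhole-fibre {b} {suc m} k f k*[1+m]<b with suc k ≤? ∣ fibre f zero ∣
... | yes large = zero , ≤∣p∣⇒↪ _ large
... | no small = suc c , ↪-map (to others) (injective others) lands-in-fibre τ
  where
  p : Subset b
  p = fibre f zero
  others : ∣ ∁ p ∣ ↪ ∁ p
  others = ≤∣p∣⇒↪ (∁ p) ≤-refl
  nonzero : ∀ i → zero ≢ f (to others i)
  nonzero i eq = x∈∁p⇒x∉p (to-∈ others i) (∈-subsetOf⁺ (λ i → f i ≟ zero) (sym eq))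
  g : Fin ∣ ∁ p ∣ → Fin m
  g i = punchOut (nonzero i)
  few-others : k * m < ∣ ∁ p ∣
  few-others = subst (k * m <_) (sym (∣∁p∣≡n∸∣p∣ p)) (m+n≤o⇒m≤o∸n (suc (k * m)) bound)
    where
    open ≤-Reasoning
    bound : suc (k * m) + ∣ p ∣ ≤ b
    bound = begin
      suc (k * m) + ∣ p ∣  ≤⟨ +-monoʳ-≤ (suc (k * m)) (≮⇒≥ small) ⟩
      suc (k * m + k)      ≡⟨ cong suc (trans (+-comm (k * m) k) (sym (*-suc k m))) ⟩
      suc (k * suc m)      ≤⟨ k*[1+m]<b ⟩
      b                    ∎
  ih : ∃ λ c → suc k ↪ fibre g c
  ih = pigeonhole-fibre k g few-others
  c : Fin m
  c = proj₁ ih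
  τ : suc k ↪ fibre g c
  τ = proj₂ ih
  lands-in-fibre : ∀ {i} → i ∈ fibre g c → to others i ∈ fibre f (suc c)
  lands-in-fibre {i} i∈ = ∈-subsetOf⁺ (λ i → f i ≟ suc c) (begin
    f (to others i)  ≡˘⟨ punchIn-punchOut (nonzero i) ⟩
    suc (g i)        ≡⟨ cong suc (∈-subsetOf⁻ (λ i → g i ≟ c) i∈) ⟩
    suc c            ∎)
    where open ≡-Reasoning

Disjoint : (G : Graph) {a u : ℕ} → Family G a → Family G u → Set
Disjoint G A F = ∀ v → InV G v A → ¬ InV G v F

Sparse : (G : Graph) (l : ℕ) {a u : ℕ} → Family G a → Family G u → Set
Sparse G l A F = ∀ v → InV G v A → #nbrPaths G v F < l

ClusterFromTo : (G : Graph) (s l : ℕ) {a u : ℕ} → Family G a → Family G u → Set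
ClusterFromTo G s l A F = Σ (VSet G) λ S → Σ (Family G l) λ 𝓛 →
  IsCluster G s l S 𝓛 × (∀ v → v ∈ S → InV G v A) × SubFam G 𝓛 F

module _ (G : Graph) where

  IsPath⇒Nonempty : ∀ {P} → IsPath G P → Nonempty P
  IsPath⇒Nonempty (_ , p , _ , p-onto , _) =
    p zero , Equivalence.from (p-onto (p zero)) (zero , refl)

  IsPolypath-reindex : ∀ {a w} {A : Family G a} {g : Fin w → Fin a} →
                       IsPolypath G a A → Injective _≡_ _≡_ g → IsPolypath G w (A ∘ g)
  IsPolypath-reindex (paths , disjoint) g-inj =
    paths ∘ _ , λ i j i≢j → disjoint _ _ (i≢j ∘ g-inj)

  polypath-index-unique : ∀ {a} {A : Family G a} → IsPolypath G a A →
                          ∀ {v i j} → v ∈ A i → v ∈ A j → i ≡ j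
  polypath-index-unique (_ , disjoint) {v} {i} {j} v∈Ai v∈Aj with i ≟ j
  ... | yes i≡j = i≡j
  ... | no i≢j = ⊥-elim (disjoint i j i≢j v v∈Ai v∈Aj)

  module _ {u} (x : Vertex G) (F : Family G u) where

    ∈-nbrPaths⁺ : ∀ {j} → HasNbrIn G x (F j) → j ∈ nbrPaths G x F
    ∈-nbrPaths⁺ = ∈-subsetOf⁺ (λ j → nonempty? (F j ∩ Nbhd G x))

    ∈-nbrPaths⁻ : ∀ {j} → j ∈ nbrPaths G x F → HasNbrIn G x (F j)
    ∈-nbrPaths⁻ = ∈-subsetOf⁻ (λ j → nonempty? (F j ∩ Nbhd G x))

  #nbrPaths-reindex : ∀ {u w} (x : Vertex G) (F : Family G u) {r : Fin w → Fin u} →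
                      Injective _≡_ _≡_ r → #nbrPaths G x (F ∘ r) ≤ #nbrPaths G x F
  #nbrPaths-reindex x F {r} r-inj = ↪⇒≤∣p∣
    (↪-map r r-inj (∈-nbrPaths⁺ x F ∘ ∈-nbrPaths⁻ x (F ∘ r)) (≤∣p∣⇒↪ _ ≤-refl))

  cluster-reindex : ∀ {s l a a′ u u′} {A : Family G a} {F : Family G u}
                    (g : Fin a′ → Fin a) (r : Fin u′ → Fin u) →
                    ClusterFromTo G s l (A ∘ g) (F ∘ r) → ClusterFromTo G s l A F
  cluster-reindex g r (S , 𝓛 , cluster , S⊆A , 𝓛⊆F) =
    S , 𝓛 , cluster , (λ v v∈S → let i , v∈ = S⊆A v v∈S in g i , v∈)
                     , (λ k → let j , eq = 𝓛⊆F k in r j , eq)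

  commonNeighbours⇒cluster :
    ∀ {s l a u} {A : Family G a} {F : Family G u} → IsPolypath G u F → Disjoint G A F →
    (v : Fin s → Vertex G) → Injective _≡_ _≡_ v → (∀ k → InV G (v k) A) →
    (σ : Fin l → Fin u) → Injective _≡_ _≡_ σ → (∀ k j → HasNbrIn G (v k) (F (σ j))) →
    ClusterFromTo G s l A F
  commonNeighbours⇒cluster {A = A} {F} F-poly A∩F v v-inj v∈A σ σ-inj adjacent =
    image v , F ∘ σ
    , (∣image∣≡ v v-inj , IsPolypath-reindex F-poly σ-inj , avoids , sees)
    , S⊆A , (λ j → σ j , refl)
    where
    S⊆A : ∀ x → x ∈ image v → InV G x A
    S⊆A x x∈S with ∈-image⁻ v x∈S
    ... | k , refl = v∈A k
    avoids : ∀ x → InV G x (F ∘ σ) → x ∉ image v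
    avoids x (j , x∈) x∈S = A∩F x (S⊆A x x∈S) (σ j , x∈)
    sees : ∀ x → x ∈ image v → ∀ j → HasNbrIn G x (F (σ j))
    sees x x∈S j with ∈-image⁻ v x∈S
    ... | k , refl = adjacent k j

module _ (G : Graph) (s l : ℕ) {a u : ℕ} (A : Family G a) (F : Family G u)
         (A-poly : IsPolypath G a A) (F-poly : IsPolypath G u F) (A∩F : Disjoint G A F) where

  HasDenseVertex : Fin a → Set
  HasDenseVertex i = ∃ λ x → x ∈ A i × l ≤ #nbrPaths G x F

  dense : Subset a
  dense = subsetOf (λ i → any? (λ x → (x ∈? A i) ×-dec (l ≤? #nbrPaths G x F)))

  -- Each dense path is labelled by l paths of F seen by one of its dense vertices,
  -- encoded as an element of Fin (u ^ l); s paths with the same label give a cluster.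
  many-dense⇒cluster : (s ∸ 1) * u ^ l < ∣ dense ∣ → ClusterFromTo G s l A F
  many-dense⇒cluster many =
    commonNeighbours⇒cluster G F-poly A∩F (x ∘ chosen) x∘chosen-injective
      (λ k → to enum (chosen k) , x∈A (chosen k)) (finToFun c) label-injective adjacent
    where
    enum : ∣ dense ∣ ↪ dense
    enum = ≤∣p∣⇒↪ dense ≤-refl
    witness : ∀ k → HasDenseVertex (to enum k)
    witness k = ∈-subsetOf⁻ _ (to-∈ enum k)
    x : Fin ∣ dense ∣ → Vertex G
    x k = proj₁ (witness k)
    x∈A : ∀ k → x k ∈ A (to enum k)
    x∈A k = proj₁ (proj₂ (witness k))
    x-injective : Injective _≡_ _≡_ x
    x-injective {k} {k′} eq = injective enum
      (polypath-index-unique G A-poly (x∈A k) (subst (_∈ A (to enum k′)) (sym eq) (x∈A k′)))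
    seen : ∀ k → l ↪ nbrPaths G (x k) F
    seen k = ≤∣p∣⇒↪ _ (proj₂ (proj₂ (witness k)))
    label : Fin ∣ dense ∣ → Fin (u ^ l)
    label k = funToFin (to (seen k))
    large-fibre : ∃ λ c → suc (s ∸ 1) ↪ fibre label c
    large-fibre = pigeonhole-fibre (s ∸ 1) label many
    c : Fin (u ^ l)
    c = proj₁ large-fibre
    τ : suc (s ∸ 1) ↪ fibre label c
    τ = proj₂ large-fibre
    -- the fibre has suc (s ∸ 1) elements, which is at least s even when s = 0
    pick : Fin s → Fin (suc (s ∸ 1))
    pick k = inject≤ k (m≤n+m∸n s 1)
    chosen : Fin s → Fin ∣ dense ∣
    chosen = to τ ∘ pick
    x∘chosen-injective : Injective _≡_ _≡_ (x ∘ chosen)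
    x∘chosen-injective {k} {k′} eq = inject≤-injective _ _ k k′ (injective τ (x-injective eq))
    agrees : ∀ {k} → k ∈ fibre label c → ∀ j → finToFun c j ≡ to (seen k) j
    agrees {k} k∈ j = begin
      finToFun c j          ≡˘⟨ cong (λ d → finToFun d j)
                                     (∈-subsetOf⁻ (λ i → label i ≟ c) k∈) ⟩
      finToFun (label k) j  ≡⟨ finToFun-funToFin (to (seen k)) j ⟩
      to (seen k) j         ∎
      where open ≡-Reasoning
    label-injective : Injective _≡_ _≡_ (finToFun c)
    label-injective {j} {j′} eq = injective (seen (to τ zero))
      (trans (sym (agrees (to-∈ τ zero) j)) (trans eq (agrees (to-∈ τ zero) j′)))
    adjacent : ∀ k j → HasNbrIn G (x (chosen k)) (F (finToFun c j))
    adjacent k j = subst (λ i → HasNbrIn G (x (chosen k)) (F i))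
      (sym (agrees (to-∈ τ (pick k)) j))
      (∈-nbrPaths⁻ G (x (chosen k)) F (to-∈ (seen (chosen k)) j))

  few-dense⇒sparse : ∀ w → w + (s ∸ 1) * u ^ l ≤ a → ∣ dense ∣ ≤ (s ∸ 1) * u ^ l →
                     Σ (Fin w → Fin a) λ γ → Injective _≡_ _≡_ γ × Sparse G l (A ∘ γ) F
  few-dense⇒sparse w enough few =
    to sparse-paths , injective sparse-paths , λ v (k , v∈) → ≰⇒> λ v-dense →
      x∈∁p⇒x∉p (to-∈ sparse-paths k) (∈-subsetOf⁺ _ (v , v∈ , v-dense))
    where
    sparse-paths : w ↪ ∁ dense
    sparse-paths = ≤∣p∣⇒↪ (∁ dense) (subst (w ≤_) (sym (∣∁p∣≡n∸∣p∣ dense))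
      (m+n≤o⇒m≤o∸n w (≤-trans (+-monoʳ-≤ w few) enough)))

  cluster⊎sparse : ∀ w → w + (s ∸ 1) * u ^ l ≤ a →
                   ClusterFromTo G s l A F
                   ⊎ Σ (Fin w → Fin a) λ γ → Injective _≡_ _≡_ γ × Sparse G l (A ∘ γ) F
  cluster⊎sparse w enough with (s ∸ 1) * u ^ l <? ∣ dense ∣
  ... | yes many = inj₁ (many-dense⇒cluster many)
  ... | no ¬many = inj₂ (few-dense⇒sparse w enough (≮⇒≥ ¬many))

Alternatives : (G : Graph) (s l w : ℕ) {a a′ : ℕ} → Family G a → Family G a′ → Set
Alternatives G s l w Q Q′ =
  (Σ (VSet G) λ S → Σ (Family G l) λ 𝓛 → IsCluster G s l S 𝓛
     × (((∀ v → v ∈ S → InV G v Q) × SubFam G 𝓛 Q′)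
        ⊎ ((∀ v → v ∈ S → InV G v Q′) × SubFam G 𝓛 Q)))
  ⊎ (Σ (Family G w) λ 𝓦 → Σ (Family G w) λ 𝓦′
       → IsPolypath G w 𝓦 × SubFam G 𝓦 Q
       × IsPolypath G w 𝓦′ × SubFam G 𝓦′ Q′
       × Sparse G l 𝓦 𝓦′ × Sparse G l 𝓦′ 𝓦)

module _ (G : Graph) {s l w a a′ : ℕ} {Q : Family G a} {Q′ : Family G a′} where

  clusterFrom⇒alternatives : ClusterFromTo G s l Q Q′ → Alternatives G s l w Q Q′
  clusterFrom⇒alternatives (S , 𝓛 , cluster , S⊆Q , 𝓛⊆Q′) =
    inj₁ (S , 𝓛 , cluster , inj₁ (S⊆Q , 𝓛⊆Q′))

  clusterTo⇒alternatives : ClusterFromTo G s l Q′ Q → Alternatives G s l w Q Q′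
  clusterTo⇒alternatives (S , 𝓛 , cluster , S⊆Q′ , 𝓛⊆Q) =
    inj₁ (S , 𝓛 , cluster , inj₂ (S⊆Q′ , 𝓛⊆Q))

module _ (G : Graph) (s l w t : ℕ) {a a′ : ℕ} (Q : Family G a) (Q′ : Family G a′)
         (Q-poly : IsPolypath G a Q) (Q′-poly : IsPolypath G a′ Q′) (Q∩Q′ : Disjoint G Q Q′)
         (t≤a′ : t ≤ a′) where

  private
    ι : Fin t → Fin a′
    ι i = inject≤ i t≤a′
    T′ : Family G t
    T′ = Q′ ∘ ι
    T′-poly : IsPolypath G t T′
    T′-poly = IsPolypath-reindex G Q′-poly (inject≤-injective t≤a′ t≤a′ _ _)

  alternatives : w + (s ∸ 1) * w ^ l ≤ t → w + (s ∸ 1) * t ^ l ≤ a →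
                 Alternatives G s l w Q Q′
  alternatives w-from-t t-from-a
    with cluster⊎sparse G s l Q T′ Q-poly T′-poly
           (λ v v∈Q (i , v∈T′) → Q∩Q′ v v∈Q (ι i , v∈T′)) w t-from-a
  ... | inj₁ cluster = clusterFrom⇒alternatives G (cluster-reindex G id ι cluster)
  ... | inj₂ (γ , γ-inj , W-sparse)
    with cluster⊎sparse G s l T′ (Q ∘ γ) T′-poly (IsPolypath-reindex G Q-poly γ-inj)
           (λ v (i , v∈T′) (k , v∈W) → Q∩Q′ v (γ k , v∈W) (ι i , v∈T′)) w w-from-t
  ...   | inj₁ cluster = clusterTo⇒alternatives G (cluster-reindex G ι γ cluster)
  ...   | inj₂ (δ , δ-inj , W′-sparse) =
    inj₂ (Q ∘ γ , T′ ∘ δ , IsPolypath-reindex G Q-poly γ-inj , (λ k → γ k , refl)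
         , IsPolypath-reindex G T′-poly δ-inj , (λ k → ι (δ k) , refl)
         , (λ v v∈W → ≤-<-trans (#nbrPaths-reindex G v T′ δ-inj) (W-sparse v v∈W))
         , W′-sparse)

m≤m^[1+n] : ∀ m n → m ≤ m ^ suc n
m≤m^[1+n] zero n = z≤n
m≤m^[1+n] (suc m) n = begin
  suc m              ≡˘⟨ *-identityʳ (suc m) ⟩
  suc m * 1          ≤⟨ *-monoʳ-≤ (suc m) (m^n>0 (suc m) n) ⟩
  suc m * suc m ^ n  ∎
  where open ≤-Reasoning

^-distrib-* : ∀ m n o → (m * n) ^ o ≡ m ^ o * n ^ o
^-distrib-* m n zero = refl
^-distrib-* m n (suc o) = begin
  m * n * (m * n) ^ o      ≡⟨ cong (m * n *_) (^-distrib-* m n o) ⟩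
  m * n * (m ^ o * n ^ o)  ≡⟨ interchange m n (m ^ o) (n ^ o) ⟩
  m * m ^ o * (n * n ^ o)  ∎
  where open ≡-Reasoning

reserve : (s l w : ℕ) → ℕ
reserve s l w = w + (s ∸ 1) * w ^ l

module _ (s w l′ : ℕ) where

  private
    l = suc l′
    t = reserve s l w
    P = suc s ^ l
    W = w ^ (l * l)

  reserve≤ : t ≤ suc s * w ^ l
  reserve≤ = begin
    w + (s ∸ 1) * w ^ l    ≤⟨ +-monoˡ-≤ _ (m≤m^[1+n] w l′) ⟩
    suc (s ∸ 1) * w ^ l    ≤⟨ *-monoˡ-≤ (w ^ l) (s≤s (m∸n≤m s 1)) ⟩
    suc s * w ^ l          ∎
    where open ≤-Reasoning

  first-step-fits : w + (s ∸ 1) * t ^ l ≤ suc s ^ (l + 1) * W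
  first-step-fits = begin
    w + (s ∸ 1) * t ^ l  ≤⟨ +-mono-≤ (m≤m^[1+n] w (l′ + l′ * l))
                                     (*-mono-≤ (m∸n≤m s 1) t^l≤) ⟩
    W + s * (P * W)      ≤⟨ +-monoˡ-≤ _ (m≤n*m W P {{m^n≢0 (suc s) l}}) ⟩
    suc s * (P * W)      ≡˘⟨ *-assoc (suc s) P W ⟩
    suc s ^ suc l * W    ≡⟨ cong (λ e → suc s ^ e * W) (+-comm 1 l) ⟩
    suc s ^ (l + 1) * W  ∎
    where
    open ≤-Reasoning
    t^l≤ : t ^ l ≤ P * W
    t^l≤ = begin
      t ^ l                ≤⟨ ^-monoˡ-≤ l reserve≤ ⟩
      (suc s * w ^ l) ^ l  ≡⟨ ^-distrib-* (suc s) (w ^ l) l ⟩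
      P * (w ^ l) ^ l      ≡⟨ cong (P *_) (^-*-assoc w l l) ⟩
      P * W                ∎

  reserve-fits : t ≤ suc s ^ (l + 1) * W
  reserve-fits =
    ≤-trans (+-monoʳ-≤ w (*-monoʳ-≤ (s ∸ 1) (^-monoˡ-≤ l (m≤m+n w _)))) first-step-fits

lemma5p6 : (l s w : ℕ) (G : Graph)
    → (𝓠 𝓠′ : Family G ((suc s ^ (l + 1)) * (w ^ (l * l))))
    → IsPolypath G _ 𝓠 → IsPolypath G _ 𝓠′
    → (∀ v → InV G v 𝓠 → ¬ (InV G v 𝓠′))
    → (Σ (VSet G) λ S → Σ (Family G l) λ 𝓛 → IsCluster G s l S 𝓛
         × (((∀ v → v ∈ S → InV G v 𝓠) × SubFam G 𝓛 𝓠′)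
            ⊎ ((∀ v → v ∈ S → InV G v 𝓠′) × SubFam G 𝓛 𝓠)))
      ⊎ (Σ (Family G w) λ 𝓦 → Σ (Family G w) λ 𝓦′
           → IsPolypath G w 𝓦 × SubFam G 𝓦 𝓠
           × IsPolypath G w 𝓦′ × SubFam G 𝓦′ 𝓠′
           × (∀ v → InV G v 𝓦 → #nbrPaths G v 𝓦′ < l)
           × (∀ v → InV G v 𝓦′ → #nbrPaths G v 𝓦 < l))
-- No vertex is 0-sparse, so a single path of 𝓠 already forces a cluster.
lemma5p6 zero s w G 𝓠 𝓠′ 𝓠-poly 𝓠′-poly 𝓠∩𝓠′ =
  case cluster⊎sparse G s 0 𝓠 𝓠′ 𝓠-poly 𝓠′-poly 𝓠∩𝓠′ 1 one-path of λ where
    (inj₁ cluster) → clusterFrom⇒alternatives G cluster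
    (inj₂ (γ , _ , sparse)) →
      let x , x∈ = IsPath⇒Nonempty G (proj₁ 𝓠-poly (γ zero))
      in contradiction (sparse x (zero , x∈)) λ ()
  where
  one-path : 1 + (s ∸ 1) * 1 ≤ suc s * 1 * 1
  one-path = begin
    suc ((s ∸ 1) * 1)  ≡⟨ cong suc (*-identityʳ (s ∸ 1)) ⟩
    suc (s ∸ 1)        ≤⟨ s≤s (m∸n≤m s 1) ⟩
    suc s              ≡˘⟨ trans (*-identityʳ (suc s * 1)) (*-identityʳ (suc s)) ⟩
    suc s * 1 * 1      ∎
    where open ≤-Reasoning
lemma5p6 (suc l′) s w G 𝓠 𝓠′ 𝓠-poly 𝓠′-poly 𝓠∩𝓠′ =
  alternatives G s (suc l′) w (reserve s (suc l′) w) 𝓠 𝓠′ 𝓠-poly 𝓠′-poly 𝓠∩𝓠′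
               (reserve-fits s w l′) ≤-refl (first-step-fits s w l′)
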